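{- Every integer $r\ge 2$ with $r\equiv 1 \pmod 6$ or $r\equiv 5\pmod 6$ is distinguished with respect to $(3,1)$.
   Context: For integers $s$ and $r\ge 1$ with $\gcd(r,s)=1$, $\operatorname{ord}_r(s)$ denotes the multiplicative order of $s$ modulo $r$, i.e. the least positive integer $m$ with $s^m\equiv 1\pmod r$. An integer $r\ge 2$ is distinguished with respect to $(3,1)$ (or $(3,1)$-distinguished) if $\gcd(r,3)=1$ and $r$ divides $\frac{3^{\operatorname{ord}_r(3)}-1}{3-1}$. -}

module Defs where

open import Data.Nat using (ℕ; _^_; _∸_; _<_; _≤_)
open import Data.Nat.Divisibility using (_∣_)
open import Data.Nat.DivMod using (_/_)
open import Data.Nat.Coprimality using (Coprime)
open import Data.Product using (_×_)

-- s^m ≡ 1 (mod r), for s ≥ 1 (so s^m ≥ 1 and truncated subtraction is exact)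
PowCongOne : ℕ → ℕ → ℕ → Set
PowCongOne r s m = r ∣ (s ^ m ∸ 1)

IsOrd : ℕ → ℕ → ℕ → Set
IsOrd r s m = (0 < m) × PowCongOne r s m × (∀ k → 0 < k → PowCongOne r s k → m ≤ k)

-- r is (3,1)-distinguished: r ≥ 2, gcd(r,3)=1 and r ∣ (3^{ord_r 3} - 1)/(3 - 1)
Distinguished31 : ℕ → Set
Distinguished31 r = (2 ≤ r) × Coprime r 3 × (∀ m → IsOrd r 3 m → r ∣ ((3 ^ m ∸ 1) / 2))

{-# OPTIONS --safe #-}
-- r ≡ ±1 (mod 6) makes r prime to 2 and 3. Since 2 = 3 − 1 divides 3^m − 1 and r is odd,
-- r ∣ 3^m − 1 already gives r ∣ (3^m − 1)/2 for every m.

module Submission where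

open import Defs
open import Data.Nat using (ℕ; zero; suc; _+_; _*_; _^_; _∸_; _/_; _%_; _≤_; NonZero)
open import Data.Nat.Properties using (*-zeroʳ; *-comm)
open import Data.Nat.Divisibility
  using (_∣_; _∤_; divides; _∣?_; ∣-refl; ∣-trans; ∣m∣n⇒∣m+n; n∣m*n; %-presˡ-∣)
open import Data.Nat.DivMod using (m*n/n≡m)
open import Data.Nat.Coprimality using (Coprime; coprime-divisor)
open import Data.Nat.Primality using (Prime; prime?; prime⇒irreducible)
open import Data.Nat.Tactic.RingSolver using (solve-∀)
open import Data.Sum using (_⊎_; inj₁; inj₂)
open import Data.Product using (_,_)
open import Relation.Nullary using (contradiction)
open import Relation.Nullary.Decidable using (from-yes; from-no)
open import Relation.Binary.PropositionalEquality using (_≡_; refl; subst; sym; cong)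

pred-∣-pow-pred : ∀ s m → s ∸ 1 ∣ s ^ m ∸ 1
pred-∣-pow-pred zero    zero    = divides 0 refl
pred-∣-pow-pred zero    (suc m) = divides 0 refl
pred-∣-pow-pred (suc t) zero    = divides 0 refl
pred-∣-pow-pred (suc t) (suc m) = ∣a∸1⇒∣[1+t]*a∸1 (suc t ^ m) (pred-∣-pow-pred (suc t) m)
  where
  ∣a∸1⇒∣[1+t]*a∸1 : ∀ a → t ∣ a ∸ 1 → t ∣ suc t * a ∸ 1
  ∣a∸1⇒∣[1+t]*a∸1 zero    _   = divides 0 (cong (_∸ 1) (*-zeroʳ (suc t)))
  ∣a∸1⇒∣[1+t]*a∸1 (suc u) t∣u = subst (t ∣_) (sym (expand t u))
    (∣m∣n⇒∣m+n (∣-trans t∣u (n∣m*n (suc t))) ∣-refl)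
    where
    -- the left side is what suc t * suc u ∸ 1 reduces to
    expand : ∀ t u → u + t * suc u ≡ suc t * u + t
    expand = solve-∀

prime-∤⇒coprime : ∀ {p n} → Prime p → p ∤ n → Coprime n p
prime-∤⇒coprime pp p∤n (d∣n , d∣p) with prime⇒irreducible pp d∣p
... | inj₁ d≡1 = d≡1
... | inj₂ refl = contradiction d∣n p∤n

coprime-∣⇒∣/ : ∀ {r d n} .{{_ : NonZero d}} → Coprime r d → d ∣ n → r ∣ n → r ∣ n / d
coprime-∣⇒∣/ {r} {d} r⊥d (divides q refl) r∣q*d =
  subst (r ∣_) (sym (m*n/n≡m q d)) (coprime-divisor r⊥d (subst (r ∣_) (*-comm q d) r∣q*d))

unit-residue₆⇒∤ : ∀ {p r} → p ∣ 6 → p ∤ 1 → p ∤ 5 → r % 6 ≡ 1 ⊎ r % 6 ≡ 5 → p ∤ r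
unit-residue₆⇒∤ {p} p∣6 p∤1 p∤5 (inj₁ r%6≡1) p∣r = p∤1 (subst (p ∣_) r%6≡1 (%-presˡ-∣ p∣r p∣6))
unit-residue₆⇒∤ {p} p∣6 p∤1 p∤5 (inj₂ r%6≡5) p∣r = p∤5 (subst (p ∣_) r%6≡5 (%-presˡ-∣ p∣r p∣6))

lemma2p1 : (r : ℕ) → 2 ≤ r → (r % 6 ≡ 1 ⊎ r % 6 ≡ 5) → Distinguished31 r
lemma2p1 r 2≤r unit-residue =
  2≤r , r⊥3 , λ m (_ , r∣3^m∸1 , _) → coprime-∣⇒∣/ r⊥2 (pred-∣-pow-pred 3 m) r∣3^m∸1
  where
  r⊥2 : Coprime r 2
  r⊥2 = prime-∤⇒coprime (from-yes (prime? 2))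
          (unit-residue₆⇒∤ (divides 3 refl) (from-no (2 ∣? 1)) (from-no (2 ∣? 5)) unit-residue)
  r⊥3 : Coprime r 3
  r⊥3 = prime-∤⇒coprime (from-yes (prime? 3))
          (unit-residue₆⇒∤ (divides 2 refl) (from-no (3 ∣? 1)) (from-no (3 ∣? 5)) unit-residue)
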